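{- Let $\mathcal{B}$ be a block. The following are equivalent: (1) $\mathcal{B}$ is smooth; (2) for all $s,t\in T(\mathcal{B})$ with $|s|=|t|$ and $\operatorname{ht}_{\mathcal{B}}(s)<\operatorname{ht}_{\mathcal{B}}(t)$ there exists $i<|s|$ with $s(i)<t(i)$.
   Context: Finite subsets of $\mathbb{N}$ are identified with strictly increasing sequences; $\sqsubset$ is proper initial segment. A set $\mathcal{B}\subseteq[\mathbb{N}]^{<\omega}$ is a front if either $\mathcal{B}=\{\langle\rangle\}$ (the degenerate front) or: (1) $\operatorname{base}(\mathcal{B})=\bigcup\mathcal{B}$ infinite; (2) every infinite $X\subseteq\operatorname{base}(\mathcal{B})$ has $s\in\mathcal{B}$ with $s\sqsubset X$; (3) no $s,t\in\mathcal{B}$ with $s\sqsubset t$. A block is a non-degenerate front. A front is smooth if for $s,t\in\mathcal{B}$ with $|s|<|t|$ some $i<|s|$ has $s(i)<t(i)$. $T(\mathcal{B})$: finite subsets of $\operatorname{base}(\mathcal{B})$ with no proper initial segment in $\mathcal{B}$; $\operatorname{ht}_{\mathcal{B}}(s)=0$ for $s\in\mathcal{B}$, else $\sup\{\operatorname{ht}_{\mathcal{B}}(s^\frown\langle n\rangle)+1: s^\frown\langle n\rangle\in T(\mathcal{B})\}$. -}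

module Defs where

open import Data.Nat using (ℕ; zero; suc; _<_; _≤_)
open import Data.List using (List; []; _∷_; _++_; _∷ʳ_; length; map; upTo)
open import Data.List.Membership.Propositional using (_∈_)
open import Data.List.Relation.Unary.All using (All)
open import Data.List.Relation.Unary.Linked using (Linked)
open import Data.Product using (Σ; _×_; ∃; ∃-syntax)
open import Relation.Binary.PropositionalEquality using (_≡_; _≢_)
open import Relation.Nullary using (¬_)

-- Finite subsets of ℕ = strictly increasing lists.
StrictInc : List ℕ → Set
StrictInc = Linked _<_

Family : Set₁
Family = List ℕ → Set

_⊏_ : List ℕ → List ℕ → Set
s ⊏ t = Σ (List ℕ) λ u → (u ≢ []) × (s ++ u ≡ t)

-- Infinite subsets of ℕ = strictly increasing enumerations ℕ → ℕ.
IsIncSeq : (ℕ → ℕ) → Set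
IsIncSeq X = ∀ n → X n < X (suc n)

_⊏∞_ : List ℕ → (ℕ → ℕ) → Set
s ⊏∞ X = s ≡ map X (upTo (length s))

InBase : Family → ℕ → Set
InBase B n = ∃[ s ] (B s × n ∈ s)

-- s(i) = a  (i-th entry of a list, 0-indexed; implies i < |s|)
data _at_≡_ : List ℕ → ℕ → ℕ → Set where
  here  : ∀ {x xs} → (x ∷ xs) at 0 ≡ x
  there : ∀ {x xs i y} → xs at i ≡ y → (x ∷ xs) at suc i ≡ y

record IsBlock (B : Family) : Set where
  field
    finiteSubsets : ∀ s → B s → StrictInc s
    baseInfinite  : ∀ m → ∃[ n ] (m ≤ n × InBase B n)
    barring       : ∀ (X : ℕ → ℕ) → IsIncSeq X → (∀ n → InBase B (X n)) →
                    ∃[ s ] (B s × s ⊏∞ X)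
    antichain     : ∀ s t → B s → B t → ¬ (s ⊏ t)

SomeSmaller : List ℕ → List ℕ → Set
SomeSmaller s t = ∃[ i ] ∃[ a ] ∃[ b ] (s at i ≡ a × t at i ≡ b × a < b)

Smooth : Family → Set
Smooth B = ∀ s t → B s → B t → length s < length t → SomeSmaller s t

T : Family → List ℕ → Set
T B s = StrictInc s × All (InBase B) s × (∀ u → u ⊏ s → ¬ B u)

-- Since ht_B(s) = sup { ht_B(s⌢n) + 1 : s⌢n ∈ T(B) },
-- ordinal comparison unfolds to:
--   ht(s) ≤ ht(t)  iff  ht(s⌢n) < ht(t) for every child s⌢n ∈ T(B)
--   ht(s) < ht(t)  iff  ht(s) ≤ ht(t⌢n) for some child t⌢n ∈ T(B)
-- (defined inductively, i.e. by well-founded recursion along T(B)).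
data HtLe (B : Family) : List ℕ → List ℕ → Set
data HtLt (B : Family) : List ℕ → List ℕ → Set

data HtLe B where
  le : ∀ {s t} → (∀ n → T B (s ∷ʳ n) → HtLt B (s ∷ʳ n) t) → HtLe B s t

data HtLt B where
  lt : ∀ {s t} n → T B (t ∷ʳ n) → HtLe B s (t ∷ʳ n) → HtLt B s t

Condition2 : Family → Set
Condition2 B = ∀ s t → T B s → T B t → length s ≡ length t →
               HtLt B s t → SomeSmaller s t

-- Smooth ⇒ (2), contrapositively: suppose |s| = |t|, ht(s) < ht(t) witnessed by a child
-- t ∷ʳ n, and t(i) ≤ s(i) for all i.  If s ∉ B, extend s by an element m ≥ n of the base
-- larger than s; then ht(s ∷ʳ m) < ht(t ∷ʳ n) and the pointwise inequality persists, so
-- recurse along the height comparison.  If s ∈ B, extend t ∷ʳ n to some v ∈ B; as |s| < |v|,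
-- smoothness gives s(i) < v(i) = t(i) for some i < |s|, a contradiction.  The case split on
-- s ∈ B is classical, which is harmless since SomeSmaller is decidable.
-- (2) ⇒ smooth: for s, t ∈ B with |s| < |t| write t = p ++ n ∷ w with |p| = |s|; then
-- ht(s) = 0 < ht(p) because p ∷ʳ n ∈ T(B), and (2) applies to s and p.
{-# OPTIONS --safe #-}
module Submission where

open import Defs
open import Function.Bundles using (_⇔_; mk⇔)

open import Data.Nat using (ℕ; zero; suc; _<_; _≤_; _<?_; z≤n; s≤s)
open import Data.Nat.Properties
  using (≤-reflexive; ≤-trans; ≤-<-trans; <-≤-trans; <-irrefl; <⇒≤; <⇒≱)
open import Data.List using (List; []; _∷_; _++_; _∷ʳ_; [_]; length; applyUpTo)
open import Data.List.Properties
  using (∷-injective; ∷-injectiveˡ; ∷-injectiveʳ; ++-assoc; ++-identityʳ; ++-conicalˡ; ++-conicalʳ;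
         length-++-sucʳ; length-++-≤ˡ; length-++-comm; map-applyUpTo)
open import Data.List.Extrema.Nat using (max; xs≤max; ⊥≤max)
open import Data.List.Relation.Unary.All as All using (All; []; _∷_)
open import Data.List.Relation.Unary.All.Properties using (++⁻ˡ; ∷ʳ⁺)
open import Data.List.Relation.Unary.Linked as Linked using (Linked; []; [-]; _∷_)
open import Data.Product as Product using (_×_; _,_; proj₁; proj₂; ∃-syntax; Σ-syntax)
open import Data.Sum as Sum using (_⊎_; inj₁; inj₂)
open import Data.Empty using (⊥; ⊥-elim)
open import Function using (id; _∘_)
open import Relation.Binary.PropositionalEquality using (_≡_; refl; sym; trans; cong; subst)
open import Relation.Nullary using (¬_; Dec; yes; no)
open import Relation.Nullary.Decidable using (decidable-stable; ¬¬-excluded-middle)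

_⊑_ : List ℕ → List ℕ → Set
s ⊑ t = ∃[ w ] (s ++ w ≡ t)

⊏⇒⊑ : ∀ {s t} → s ⊏ t → s ⊑ t
⊏⇒⊑ = Product.map₂ proj₂

⊏⇒length< : ∀ {s t} → s ⊏ t → length s < length t
⊏⇒length< ([] , u≢[] , _) = ⊥-elim (u≢[] refl)
⊏⇒length< {s} (x ∷ u , _ , refl) =
  subst (length s <_) (sym (length-++-sucʳ s x u)) (s≤s (length-++-≤ˡ s))

⊏-∷ʳ⁻ : ∀ u s {m} → u ⊏ (s ∷ʳ m) → u ⊑ s
⊏-∷ʳ⁻ [] s _ = s , refl
⊏-∷ʳ⁻ (x ∷ u) [] (w , w≢[] , e) = ⊥-elim (w≢[] (++-conicalʳ u w (∷-injectiveʳ e)))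
⊏-∷ʳ⁻ (x ∷ u) (y ∷ s) (w , w≢[] , e) with ∷-injectiveˡ e
... | refl = Product.map₂ (cong (x ∷_)) (⊏-∷ʳ⁻ u s (w , w≢[] , ∷-injectiveʳ e))

⊏-++ʳ : ∀ {u p} w → u ⊏ p → u ⊏ (p ++ w)
⊏-++ʳ {u} w (a , a≢[] , refl) = a ++ w , a≢[] ∘ ++-conicalˡ a w , sym (++-assoc u a w)

∷ʳ-⊑⇒⊏ : ∀ {t n v} → (t ∷ʳ n) ⊑ v → t ⊏ v
∷ʳ-⊑⇒⊏ {t} {n} (w , refl) = n ∷ w , (λ ()) , sym (++-assoc t [ n ] w)

<length⇒split : ∀ k (t : List ℕ) → k < length t →
                Σ[ p ∈ List ℕ ] Σ[ n ∈ ℕ ] Σ[ w ∈ List ℕ ] (length p ≡ k × p ++ n ∷ w ≡ t)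
<length⇒split zero (x ∷ t) _ = [] , x , t , refl , refl
<length⇒split (suc k) (x ∷ t) (s≤s k<|t|) with <length⇒split k t k<|t|
... | p , n , w , refl , refl = x ∷ p , n , w , refl , refl

Linked-++⁻ˡ : ∀ xs {ys} → Linked _<_ (xs ++ ys) → Linked _<_ xs
Linked-++⁻ˡ [] _ = []
Linked-++⁻ˡ (x ∷ []) _ = [-]
Linked-++⁻ˡ (x ∷ y ∷ xs) (x<y ∷ l) = x<y ∷ Linked-++⁻ˡ (y ∷ xs) l

Linked-∷ʳ⁺ : ∀ xs {m} → Linked _<_ xs → All (_< m) xs → Linked _<_ (xs ∷ʳ m)
Linked-∷ʳ⁺ [] _ _ = [-]
Linked-∷ʳ⁺ (x ∷ []) _ (x<m ∷ []) = x<m ∷ [-]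
Linked-∷ʳ⁺ (x ∷ y ∷ xs) (x<y ∷ l) (_ ∷ ys<m) = x<y ∷ Linked-∷ʳ⁺ (y ∷ xs) l ys<m

at-++⁺ˡ : ∀ {xs ys i b} → xs at i ≡ b → (xs ++ ys) at i ≡ b
at-++⁺ˡ here = here
at-++⁺ˡ (there p) = there (at-++⁺ˡ p)

at-++⁻ˡ : ∀ xs {ys i b} → (xs ++ ys) at i ≡ b → i < length xs → xs at i ≡ b
at-++⁻ˡ (x ∷ xs) here _ = here
at-++⁻ˡ (x ∷ xs) (there p) (s≤s i<|xs|) = there (at-++⁻ˡ xs p i<|xs|)

at⇒<length : ∀ {xs i a} → xs at i ≡ a → i < length xs
at⇒<length here = s≤s z≤n
at⇒<length (there p) = s≤s (at⇒<length p)

at-∷ʳ⁻ : ∀ xs {x i a} → (xs ∷ʳ x) at i ≡ a → xs at i ≡ a ⊎ (i ≡ length xs × a ≡ x)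
at-∷ʳ⁻ [] here = inj₂ (refl , refl)
at-∷ʳ⁻ (y ∷ xs) here = inj₁ here
at-∷ʳ⁻ (y ∷ xs) (there p) =
  Sum.map there (Product.map₁ (cong suc)) (at-∷ʳ⁻ xs p)

someSmaller? : ∀ s t → Dec (SomeSmaller s t)
someSmaller? [] t = no λ { (_ , _ , _ , () , _) }
someSmaller? (a ∷ s) [] = no λ { (_ , _ , _ , _ , () , _) }
someSmaller? (a ∷ s) (b ∷ t) with a <? b | someSmaller? s t
... | yes a<b | _ = yes (0 , a , b , here , here , a<b)
... | no _ | yes (i , a′ , b′ , sa , tb , a′<b′) =
  yes (suc i , a′ , b′ , there sa , there tb , a′<b′)
... | no a≮b | no ¬ss = no λ
  { (0 , _ , _ , here , here , a<b) → a≮b a<b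
  ; (suc i , a′ , b′ , there sa , there tb , a′<b′) → ¬ss (i , a′ , b′ , sa , tb , a′<b′) }

SomeSmaller-⊑⁺ : ∀ {s t v} → t ⊑ v → SomeSmaller s t → SomeSmaller s v
SomeSmaller-⊑⁺ (w , refl) (i , a , b , sa , tb , a<b) = i , a , b , sa , at-++⁺ˡ tb , a<b

SomeSmaller-⊑⁻ : ∀ {s t v} → length s ≤ length t → t ⊑ v → SomeSmaller s v → SomeSmaller s t
SomeSmaller-⊑⁻ {t = t} |s|≤|t| (w , refl) (i , a , b , sa , vb , a<b) =
  i , a , b , sa , at-++⁻ˡ t vb (<-≤-trans (at⇒<length sa) |s|≤|t|) , a<b

SomeSmaller-∷ʳ⁻ : ∀ {s t m n} → length s ≡ length t →
                  SomeSmaller (s ∷ʳ m) (t ∷ʳ n) → SomeSmaller s t ⊎ m < n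
SomeSmaller-∷ʳ⁻ {s} {t} |s|≡|t| (i , a , b , sa , tb , a<b) with at-∷ʳ⁻ s sa | at-∷ʳ⁻ t tb
... | inj₁ sa′ | inj₁ tb′ = inj₁ (i , a , b , sa′ , tb′ , a<b)
... | inj₁ sa′ | inj₂ (refl , _) = ⊥-elim (<-irrefl (sym |s|≡|t|) (at⇒<length sa′))
... | inj₂ (refl , _) | inj₁ tb′ = ⊥-elim (<-irrefl |s|≡|t| (at⇒<length tb′))
... | inj₂ (_ , refl) | inj₂ (_ , refl) = inj₂ a<b

infixr 5 _++ˢ_

_++ˢ_ : List ℕ → (ℕ → ℕ) → ℕ → ℕ
([] ++ˢ X) k = X k
((x ∷ u) ++ˢ X) zero = x
((x ∷ u) ++ˢ X) (suc k) = (u ++ˢ X) k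

++ˢ-increasing : ∀ {u X} → Linked _<_ u → All (_< X 0) u → IsIncSeq X → IsIncSeq (u ++ˢ X)
++ˢ-increasing {[]} _ _ X-inc k = X-inc k
++ˢ-increasing {x ∷ []} _ (x<X₀ ∷ []) _ zero = x<X₀
++ˢ-increasing {x ∷ y ∷ u} (x<y ∷ _) _ _ zero = x<y
++ˢ-increasing {x ∷ u} u-inc (_ ∷ u<X₀) X-inc (suc k) =
  ++ˢ-increasing (Linked.tail u-inc) u<X₀ X-inc k

++ˢ-all : ∀ {P : ℕ → Set} {u X} → All P u → (∀ k → P (X k)) → ∀ k → P ((u ++ˢ X) k)
++ˢ-all [] PX k = PX k
++ˢ-all (Px ∷ _) _ zero = Px
++ˢ-all (_ ∷ Pu) PX (suc k) = ++ˢ-all Pu PX k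

⊏∞-++ˢ⁻ : ∀ u {X} v → v ⊏∞ (u ++ˢ X) → v ⊏ u ⊎ u ⊑ v
⊏∞-++ˢ⁻ u {X} v v⊏X = comparable u v (trans v⊏X (map-applyUpTo id (u ++ˢ X) (length v)))
  where
  comparable : ∀ u v → v ≡ applyUpTo (u ++ˢ X) (length v) → v ⊏ u ⊎ u ⊑ v
  comparable [] v _ = inj₂ (v , refl)
  comparable (x ∷ u) [] _ = inj₁ (x ∷ u , (λ ()) , refl)
  comparable (x ∷ u) (y ∷ v) e with ∷-injective e
  ... | refl , e′ =
    Sum.map (Product.map₂ (Product.map₂ (cong (x ∷_)))) (Product.map₂ (cong (x ∷_)))
            (comparable u v e′)

module _ {B : Family} (block : IsBlock B) where
  open IsBlock block

  above : ℕ → ℕ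
  above c = proj₁ (baseInfinite (suc c))

  <above : ∀ c → c < above c
  <above c = proj₁ (proj₂ (baseInfinite (suc c)))

  above∈base : ∀ c → InBase B (above c)
  above∈base c = proj₂ (proj₂ (baseInfinite (suc c)))

  climb : ℕ → ℕ → ℕ
  climb c zero = above c
  climb c (suc k) = above (climb c k)

  climb∈base : ∀ c k → InBase B (climb c k)
  climb∈base c zero = above∈base c
  climb∈base c (suc k) = above∈base (climb c k)

  prefix∈T : ∀ {p t} → B t → p ⊑ t → T B p
  prefix∈T {p} {t} Bt (w , refl) =
      Linked-++⁻ˡ p (finiteSubsets t Bt)
    , ++⁻ˡ p (All.tabulate (λ x∈t → t , Bt , x∈t))
    , λ u u⊏p Bu → antichain u t Bu Bt (⊏-++ʳ w u⊏p)

  T-∷ʳ⁺ : ∀ {s m} → T B s → ¬ B s → All (_< m) s → InBase B m → T B (s ∷ʳ m)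
  T-∷ʳ⁺ {s} (s-inc , s⊆base , noPrefix) ¬Bs s<m m∈base =
    Linked-∷ʳ⁺ s s-inc s<m , ∷ʳ⁺ s⊆base m∈base , noPrefix′
    where
    noPrefix′ : ∀ u → u ⊏ (s ∷ʳ _) → ¬ B u
    noPrefix′ u u⊏ Bu with ⊏-∷ʳ⁻ u s u⊏
    ... | [] , e = ¬Bs (subst B (trans (sym (++-identityʳ u)) e) Bu)
    ... | x ∷ w , e = noPrefix u (x ∷ w , (λ ()) , e) Bu

  B⇒HtLe : ∀ {s t} → B s → HtLe B s t
  B⇒HtLe {s} Bs = le λ n T[s∷ʳn] → ⊥-elim (proj₂ (proj₂ T[s∷ʳn]) s ([ n ] , (λ ()) , refl) Bs)

  T⇒⊑B : ∀ {u} → T B u → ∃[ v ] (B v × u ⊑ v)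
  T⇒⊑B {u} (u-inc , u⊆base , noPrefix) = conclude (barring X X-inc X⊆base)
    where
    c : ℕ
    c = max 0 u
    X : ℕ → ℕ
    X = u ++ˢ climb c
    X-inc : IsIncSeq X
    X-inc = ++ˢ-increasing u-inc (All.map (λ x≤c → ≤-<-trans x≤c (<above c)) (xs≤max 0 u))
                           (λ k → <above (climb c k))
    X⊆base : ∀ k → InBase B (X k)
    X⊆base = ++ˢ-all u⊆base (climb∈base c)
    conclude : ∃[ v ] (B v × v ⊏∞ X) → ∃[ v ] (B v × u ⊑ v)
    conclude (v , Bv , v⊏X) with ⊏∞-++ˢ⁻ u v v⊏X
    ... | inj₁ v⊏u = ⊥-elim (noPrefix v v⊏u Bv)
    ... | inj₂ u⊑v = v , Bv , u⊑v

  smooth⇒¬¬SomeSmaller : Smooth B → ∀ {s t} → HtLt B s t → T B s →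
                         length s ≡ length t → ¬ ¬ SomeSmaller s t
  smooth⇒¬¬SomeSmaller smooth {s} {t} (lt n T[t∷ʳn] (le childLt)) Ts |s|≡|t| ¬ss =
    ¬¬-excluded-middle λ { (yes Bs) → Bs⇒⊥ Bs ; (no ¬Bs) → ¬Bs⇒⊥ ¬Bs }
    where
    Bs⇒⊥ : B s → ⊥
    Bs⇒⊥ Bs with T⇒⊑B T[t∷ʳn]
    ... | v , Bv , t∷ʳn⊑v =
      ¬ss (SomeSmaller-⊑⁻ (≤-reflexive |s|≡|t|) (⊏⇒⊑ t⊏v) (smooth s v Bs Bv |s|<|v|))
      where
      t⊏v : t ⊏ v
      t⊏v = ∷ʳ-⊑⇒⊏ t∷ʳn⊑v
      |s|<|v| : length s < length v
      |s|<|v| = subst (_< length v) (sym |s|≡|t|) (⊏⇒length< t⊏v)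
    ¬Bs⇒⊥ : ¬ B s → ⊥
    ¬Bs⇒⊥ ¬Bs = smooth⇒¬¬SomeSmaller smooth (childLt m T[s∷ʳm]) T[s∷ʳm] |s∷ʳm|≡|t∷ʳn| ¬ss′
      where
      m : ℕ
      m = above (max n s)
      T[s∷ʳm] : T B (s ∷ʳ m)
      T[s∷ʳm] = T-∷ʳ⁺ Ts ¬Bs (All.map (λ x≤ → ≤-<-trans x≤ (<above _)) (xs≤max n s)) (above∈base _)
      |s∷ʳm|≡|t∷ʳn| : length (s ∷ʳ m) ≡ length (t ∷ʳ n)
      |s∷ʳm|≡|t∷ʳn| =
        trans (length-++-comm s [ m ]) (trans (cong suc |s|≡|t|) (sym (length-++-comm t [ n ])))
      ¬ss′ : ¬ SomeSmaller (s ∷ʳ m) (t ∷ʳ n)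
      ¬ss′ = Sum.[ ¬ss , m≮n ] ∘ SomeSmaller-∷ʳ⁻ |s|≡|t|
        where
        m≮n : ¬ m < n
        m≮n m<n = <⇒≱ m<n (≤-trans (⊥≤max n s) (<⇒≤ (<above _)))

  smooth⇒condition2 : Smooth B → Condition2 B
  smooth⇒condition2 smooth s t Ts _ |s|≡|t| ht<ht =
    decidable-stable (someSmaller? s t) (smooth⇒¬¬SomeSmaller smooth ht<ht Ts |s|≡|t|)

  condition2⇒smooth : Condition2 B → Smooth B
  condition2⇒smooth condition2 s t Bs Bt |s|<|t| with <length⇒split (length s) t |s|<|t|
  ... | p , n , w , |p|≡|s| , refl =
    SomeSmaller-⊑⁺ (n ∷ w , refl) (condition2 s p Ts Tp (sym |p|≡|s|) (lt n T[p∷ʳn] (B⇒HtLe Bs)))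
    where
    Ts : T B s
    Ts = prefix∈T Bs ([] , ++-identityʳ s)
    Tp : T B p
    Tp = prefix∈T Bt (n ∷ w , refl)
    T[p∷ʳn] : T B (p ∷ʳ n)
    T[p∷ʳn] = prefix∈T Bt (w , ++-assoc p [ n ] w)

lemma2p25 : (B : Family) → IsBlock B → Smooth B ⇔ Condition2 B
lemma2p25 B block = mk⇔ (smooth⇒condition2 block) (condition2⇒smooth block)
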